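{- Let $d=(d_i)\ne1^\infty$ be an admissible sequence. (a) Suppose $d=S_h(N,1)^\infty$ is of finite type (then necessarily $N\ge1$), and let $d'=(d'_i)$ with $d'_i:=d_{i+1+\ell_N-\ell_{N-1}}$. Then $d'_{n+1}d'_{n+2}\cdots\ge d'_1d'_2\cdots>d_2d_3\cdots$ whenever $d'_n=0$. Moreover, $d'=S(1,0)\cdots S(N-1,0)S(N,1)^\infty$ and $d_2d_3\cdots=S(1,0)\cdots S(N-1,0)S(N,0)S(N,1)^\infty$. (b) If $d$ is of infinite type, then the sequence $d'$ defined by $d'_i:=d_{1+i}$ satisfies $d'_{n+1}d'_{n+2}\cdots\ge d'_1d'_2\cdots$ whenever $d'_n=0$. (c) With $d'$ defined as in (a) or (b) according to the type of $d$, we have $d'=d$ if and only if $d=(1^{k-1}0)^\infty$ for some positive integer $k$.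
   Context: For a (finite or infinite) sequence $h=(h_j)$ of positive integers define blocks over $\{0,1\}$ by $S_h(0,1):=1$, $S_h(0,0):=0$ and for $j\ge1$: $S_h(j,1):=S_h(j-1,1)^{h_j}S_h(j-1,0)$, $S_h(j,0):=S_h(j-1,1)^{h_j-1}S_h(j-1,0)$ (concatenations; exponent $0$ gives the empty word); write $S(j,\cdot)=S_h(j,\cdot)$ and let $\ell_j$ be the length of $S(j,1)$. Sequences are compared lexicographically. A sequence $d$ of zeros and ones is admissible if $0d_2d_3\cdots\le d_{n+1}d_{n+2}\cdots\le d_1d_2\cdots$ for all $n\ge0$. An admissible sequence is of finite type if $d=S_h(N,1)^\infty$ for some integer $N\ge0$ and some finite sequence $h=(h_1,\dots,h_N)$ of positive integers; otherwise (including $d=0^\infty$) it is of infinite type. -}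

module Defs where

open import Data.Bool using (Bool; true; false)
open import Data.Nat using (ℕ; zero; suc; _+_; _∸_; _<_; _≤_; _%_; _<?_)
open import Data.List using (List; []; _∷_; _++_; length; concat; map; replicate; upTo)
open import Data.Product using (Σ; ∃; _×_)
open import Data.Sum using (_⊎_)
open import Relation.Nullary using (¬_; yes; no)
open import Relation.Binary.PropositionalEquality using (_≡_)

-- Infinite 0/1-sequences, indexed from 0: the paper's d_1 d_2 ... is d 0, d 1, ...
-- (true = 1, false = 0).
Seq : Set
Seq = ℕ → Bool

Word : Set
Word = List Bool

_≐_ : Seq → Seq → Set
a ≐ b = ∀ i → a i ≡ b i

shift : ℕ → Seq → Seq
shift n d i = d (n + i)

_<ₗ_ : Seq → Seq → Set
a <ₗ b = ∃ λ n → (∀ i → i < n → a i ≡ b i) × (a n ≡ false) × (b n ≡ true)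

_≤ₗ_ : Seq → Seq → Set
a ≤ₗ b = (a <ₗ b) ⊎ (a ≐ b)

zeroHead : Seq → Seq
zeroHead d zero = false
zeroHead d (suc i) = d (suc i)

Admissible : Seq → Set
Admissible d = ∀ n → (zeroHead d ≤ₗ shift n d) × (shift n d ≤ₗ d)

ones : Seq
ones _ = true

-- letter of a word at a position (default 0 outside)
at : Word → ℕ → Bool
at [] _ = false
at (x ∷ w) zero = x
at (x ∷ w) (suc i) = at w i

-- w^∞ (for the empty word we return 0^∞; never used on empty words)
ω : Word → Seq
ω w i with length w
... | zero = false
... | suc m = at w (i % suc m)

_⊕_ : Word → Seq → Seq
(w ⊕ s) i with i <? length w
... | yes _ = at w i
... | no _ = s (i ∸ length w)

pow : Word → ℕ → Word
pow w k = concat (replicate k w)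

-- Blocks S_h(j,b).  The sequence h = (h_1, h_2, ...) is given as a function
-- ℕ → ℕ where h j is h_j (h 0 is unused).
S : (ℕ → ℕ) → ℕ → Bool → Word
S h zero true = true ∷ []
S h zero false = false ∷ []
S h (suc j) true = pow (S h j true) (h (suc j)) ++ S h j false
S h (suc j) false = pow (S h j true) (h (suc j) ∸ 1) ++ S h j false

ℓ : (ℕ → ℕ) → ℕ → ℕ
ℓ h j = length (S h j true)

PositiveUpTo : ℕ → (ℕ → ℕ) → Set
PositiveUpTo N h = ∀ j → 1 ≤ j → j ≤ N → 1 ≤ h j

FiniteTypeWith : Seq → ℕ → (ℕ → ℕ) → Set
FiniteTypeWith d N h = PositiveUpTo N h × (d ≐ ω (S h N true))

FiniteType : Seq → Set
FiniteType d = Σ ℕ λ N → Σ (ℕ → ℕ) λ h → FiniteTypeWith d N h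

InfiniteType : Seq → Set
InfiniteType d = ¬ FiniteType d

prefixBlocks : (ℕ → ℕ) → ℕ → Word
prefixBlocks h M = concat (map (λ j → S h (suc j) false) (upTo M))

ZeroCondition : Seq → Set
ZeroCondition d' = ∀ n → d' n ≡ false → d' ≤ₗ shift (suc n) d'

IsPeriodicOnesZero : Seq → Set
IsPeriodicOnesZero d = ∃ λ k → (1 ≤ k) × (d ≐ ω (replicate (k ∸ 1) true ++ false ∷ []))

{-# OPTIONS --safe #-}
-- With m = h₁ − 1 and h⁺ = h ∘ suc, the blocks satisfy S_h(j+1,b) = Φ_m(S_h⁺(j,b)) for the
-- substitution Φ_m : 1 ↦ 1^(m+1) 0, 0 ↦ 1^m 0; consequently d = Φ_m(S_h⁺(N−1,1)^∞) and,
-- for N ≥ 2, d′ = Φ_m(0 d′_h⁺).  Φ_m is injective and strictly monotone for the lexicographic order, and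
-- every 0 of Φ_m(x) closes the image of a letter, so the tail behind it is Φ_m of a proper tail
-- of x.  Hence Φ_m(x) satisfies the zero condition whenever x is below all its proper tails,
-- which holds for 1^∞ and for 0z with z satisfying the zero condition: induction on N gives
-- the zero condition for d′.  The descriptions of d′ and d₂d₃⋯ and the inequality d₂d₃⋯ < d′
-- are identities between the words S(j,b), the last one because S(j,0) and S(j,1) first differ
-- by a 0 against a 1.  For N ≥ 2, injectivity of Φ_m separates d′ (preimage starting with 0)
-- from d (preimage starting with 1), and d from every (1^c 0)^∞, whose runs of 1s all have the
-- same length, unlike those of the Φ_m-image of a sequence containing both letters.
-- For infinite type the zero condition is admissibility at the positions n + 1.

module Submission where

open import Defs
open import Data.Bool using (Bool; true; false)
open import Data.Nat using (ℕ; zero; suc; _+_; _∸_; _≤_; _<_; z≤n; s≤s; _<?_; _%_)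
open import Data.Nat.Properties
  using (+-identityʳ; +-suc; ≮⇒≥; ∸-monoʳ-<; m∸n+n≡m; 1+n≢n; ≤-refl; ≤-trans; m≤n⇒m≤1+n; m+n∸n≡m)
open import Data.Nat.DivMod using (n%1≡0; [m+n]%n≡m%n; m<n⇒m%n≡m)
open import Data.Nat.Induction using (<-rec)
open import Data.List using ([]; _∷_; _++_; length; replicate; concat; concatMap; upTo)
open import Data.List.Properties
  using (++-assoc; ++-identityʳ; length-++; length-++-≤ˡ; concatMap-++; concatMap-cong; upTo-∷ʳ; map-upTo; map-applyUpTo)
open import Data.Product using (∃; ∃₂; _×_; _,_; proj₁; proj₂)
open import Data.Sum using (inj₁; inj₂)
open import Data.Empty using (⊥-elim)
open import Function using (_∘_)
open import Function.Bundles using (_⇔_; mk⇔; Equivalence)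
open import Level using (0ℓ)
open import Relation.Binary.Bundles using (Setoid)
import Relation.Binary.Reasoning.Setoid as SetoidReasoning
open import Relation.Nullary using (¬_; yes; no)
open import Relation.Binary.PropositionalEquality

≐-setoid : Setoid 0ℓ 0ℓ
≐-setoid = ℕ →-setoid Bool

open Setoid ≐-setoid using ()
  renaming (refl to ≐-refl; sym to ≐-sym; trans to ≐-trans; reflexive to ≐-reflexive)

module ≐-Reasoning = SetoidReasoning ≐-setoid

false≢true : false ≢ true
false≢true ()

infixr 25 _∷ˢ_ _++ˢ_

_∷ˢ_ : Bool → Seq → Seq
(b ∷ˢ s) zero = b
(b ∷ˢ s) (suc i) = s i

_++ˢ_ : Word → Seq → Seq
[] ++ˢ s = s
(b ∷ w) ++ˢ s = b ∷ˢ (w ++ˢ s)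

∷ˢ-congʳ : ∀ b {s t} → s ≐ t → b ∷ˢ s ≐ b ∷ˢ t
∷ˢ-congʳ b s≐t zero = refl
∷ˢ-congʳ b s≐t (suc i) = s≐t i

++ˢ-congʳ : ∀ w {s t} → s ≐ t → w ++ˢ s ≐ w ++ˢ t
++ˢ-congʳ [] s≐t = s≐t
++ˢ-congʳ (b ∷ w) s≐t = ∷ˢ-congʳ b (++ˢ-congʳ w s≐t)

++ˢ-assoc : ∀ u v s → (u ++ v) ++ˢ s ≐ u ++ˢ (v ++ˢ s)
++ˢ-assoc [] v s = ≐-refl
++ˢ-assoc (b ∷ u) v s = ∷ˢ-congʳ b (++ˢ-assoc u v s)

shift-cong : ∀ n {s t} → s ≐ t → shift n s ≐ shift n t
shift-cong n s≐t i = s≐t (n + i)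

shift-++ˢ : ∀ u s → shift (length u) (u ++ˢ s) ≐ s
shift-++ˢ [] s i = refl
shift-++ˢ (b ∷ u) s i = shift-++ˢ u s i

shift-∷ˢ : ∀ n s {b} → s n ≡ b → shift n s ≐ b ∷ˢ shift (suc n) s
shift-∷ˢ n s sₙ zero = trans (cong s (+-identityʳ n)) sₙ
shift-∷ˢ n s sₙ (suc i) = cong s (+-suc n i)

++ˢ-lookup-< : ∀ u s {i} → i < length u → (u ++ˢ s) i ≡ at u i
++ˢ-lookup-< (b ∷ u) s {zero} _ = refl
++ˢ-lookup-< (b ∷ u) s {suc i} (s≤s i<|u|) = ++ˢ-lookup-< u s i<|u|

++ˢ-lookup-≥ : ∀ u s {i} → ¬ i < length u → (u ++ˢ s) i ≡ s (i ∸ length u)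
++ˢ-lookup-≥ [] s _ = refl
++ˢ-lookup-≥ (b ∷ u) s {zero} i≮|u| with () ← i≮|u| (s≤s z≤n)
++ˢ-lookup-≥ (b ∷ u) s {suc i} i≮|u| = ++ˢ-lookup-≥ u s (i≮|u| ∘ s≤s)

++ˢ≐⊕ : ∀ u s → u ++ˢ s ≐ (u ⊕ s)
++ˢ≐⊕ u s i with i <? length u
... | yes i<|u| = ++ˢ-lookup-< u s i<|u|
... | no i≮|u| = ++ˢ-lookup-≥ u s i≮|u|

++ˢ-lookup-length : ∀ u b v s → ((u ++ b ∷ v) ++ˢ s) (length u) ≡ b
++ˢ-lookup-length [] b v s = refl
++ˢ-lookup-length (a ∷ u) b v s = ++ˢ-lookup-length u b v s

ω-singleton : ∀ b → ω (b ∷ []) ≐ λ _ → b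
ω-singleton b i = cong (at (b ∷ [])) (n%1≡0 i)

ω-unfold : ∀ w → 0 < length w → ω w ≐ w ++ˢ ω w
ω-unfold w@(b ∷ v) _ i with i <? length w
... | yes i<|w| = trans (cong (at w) (m<n⇒m%n≡m i<|w|)) (sym (++ˢ-lookup-< w (ω w) i<|w|))
... | no i≮|w| = trans (cong (at w) i%|w|) (sym (++ˢ-lookup-≥ w (ω w) i≮|w|))
  where
  i%|w| : i % length w ≡ (i ∸ length w) % length w
  i%|w| = trans (cong (_% length w) (sym (m∸n+n≡m (≮⇒≥ i≮|w|))))
                ([m+n]%n≡m%n (i ∸ length w) (length w))

fixpoint-unique : ∀ w → 0 < length w → ∀ {s t} → s ≐ w ++ˢ s → t ≐ w ++ˢ t → s ≐ t
fixpoint-unique w 0<|w| {s} {t} s≐ t≐ = <-rec (λ i → s i ≡ t i) step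
  where
  step : ∀ i → (∀ {j} → j < i → s j ≡ t j) → s i ≡ t i
  step i earlier with i <? length w
  ... | yes i<|w| = begin
    s i             ≡⟨ s≐ i ⟩
    (w ++ˢ s) i     ≡⟨ ++ˢ-lookup-< w s i<|w| ⟩
    at w i          ≡⟨ ++ˢ-lookup-< w t i<|w| ⟨
    (w ++ˢ t) i     ≡⟨ t≐ i ⟨
    t i             ∎
    where open ≡-Reasoning
  ... | no i≮|w| = begin
    s i                    ≡⟨ s≐ i ⟩
    (w ++ˢ s) i            ≡⟨ ++ˢ-lookup-≥ w s i≮|w| ⟩
    s (i ∸ length w)       ≡⟨ earlier (∸-monoʳ-< 0<|w| (≮⇒≥ i≮|w|)) ⟩
    t (i ∸ length w)       ≡⟨ ++ˢ-lookup-≥ w t i≮|w| ⟨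
    (w ++ˢ t) i            ≡⟨ t≐ i ⟨
    t i                    ∎
    where open ≡-Reasoning

<ₗ-resp-≐ : ∀ {a a′ b b′} → a ≐ a′ → b ≐ b′ → a <ₗ b → a′ <ₗ b′
<ₗ-resp-≐ a≐ b≐ (n , agree , aₙ , bₙ) =
  n , (λ i i<n → trans (sym (a≐ i)) (trans (agree i i<n) (b≐ i))) ,
  trans (sym (a≐ n)) aₙ , trans (sym (b≐ n)) bₙ

≤ₗ-resp-≐ : ∀ {a a′ b b′} → a ≐ a′ → b ≐ b′ → a ≤ₗ b → a′ ≤ₗ b′
≤ₗ-resp-≐ a≐ b≐ (inj₁ a<b) = inj₁ (<ₗ-resp-≐ a≐ b≐ a<b)
≤ₗ-resp-≐ a≐ b≐ (inj₂ a≐b) = inj₂ (≐-trans (≐-sym a≐) (≐-trans a≐b b≐))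

false∷ˢ<ₗtrue∷ˢ : ∀ {s t} → false ∷ˢ s <ₗ true ∷ˢ t
false∷ˢ<ₗtrue∷ˢ = 0 , (λ _ ()) , refl , refl

∷ˢ-monoʳ-<ₗ : ∀ b {s t} → s <ₗ t → b ∷ˢ s <ₗ b ∷ˢ t
∷ˢ-monoʳ-<ₗ b {s} {t} (n , agree , sₙ , tₙ) = suc n , agree′ , sₙ , tₙ
  where
  agree′ : ∀ i → i < suc n → (b ∷ˢ s) i ≡ (b ∷ˢ t) i
  agree′ zero _ = refl
  agree′ (suc i) (s≤s i<n) = agree i i<n

∷ˢ-monoʳ-≤ₗ : ∀ b {s t} → s ≤ₗ t → b ∷ˢ s ≤ₗ b ∷ˢ t
∷ˢ-monoʳ-≤ₗ b (inj₁ s<t) = inj₁ (∷ˢ-monoʳ-<ₗ b s<t)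
∷ˢ-monoʳ-≤ₗ b (inj₂ s≐t) = inj₂ (∷ˢ-congʳ b s≐t)

∷ˢ-cancelˡ-≤ₗ : ∀ b {s t} → b ∷ˢ s ≤ₗ b ∷ˢ t → s ≤ₗ t
∷ˢ-cancelˡ-≤ₗ b (inj₁ (zero , _ , bs₀ , bt₀)) with () ← trans (sym bs₀) bt₀
∷ˢ-cancelˡ-≤ₗ b (inj₁ (suc n , agree , sₙ , tₙ)) = inj₁ (n , (λ i i<n → agree (suc i) (s≤s i<n)) , sₙ , tₙ)
∷ˢ-cancelˡ-≤ₗ b (inj₂ bs≐bt) = inj₂ (bs≐bt ∘ suc)

++ˢ-monoʳ-<ₗ : ∀ w {s t} → s <ₗ t → w ++ˢ s <ₗ w ++ˢ t
++ˢ-monoʳ-<ₗ [] s<t = s<t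
++ˢ-monoʳ-<ₗ (b ∷ w) s<t = ∷ˢ-monoʳ-<ₗ b (++ˢ-monoʳ-<ₗ w s<t)

-- Run-length sequences and the substitution Φ

run : ℕ → Word
run k = replicate k true ++ false ∷ []

0<length-run : ∀ k → 0 < length (run k)
0<length-run zero = s≤s z≤n
0<length-run (suc k) = s≤s z≤n

-- runsFrom m c = 1^m 0 1^(c 0) 0 1^(c 1) 0 ⋯
runsFrom : ℕ → (ℕ → ℕ) → Seq
runsFrom zero c zero = false
runsFrom zero c (suc i) = runsFrom (c 0) (c ∘ suc) i
runsFrom (suc m) c zero = true
runsFrom (suc m) c (suc i) = runsFrom m c i

runs : (ℕ → ℕ) → Seq
runs c = runsFrom (c 0) (c ∘ suc)

runsFrom-unfold : ∀ m c → runsFrom m c ≐ run m ++ˢ runs c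
runsFrom-unfold zero c zero = refl
runsFrom-unfold zero c (suc i) = refl
runsFrom-unfold (suc m) c zero = refl
runsFrom-unfold (suc m) c (suc i) = runsFrom-unfold m c i

runsFrom-cong : ∀ m {c c′} → c ≗ c′ → runsFrom m c ≐ runsFrom m c′
runsFrom-cong zero c≗c′ zero = refl
runsFrom-cong zero {c} {c′} c≗c′ (suc i) =
  trans (cong (λ k → runsFrom k (c ∘ suc) i) (c≗c′ 0)) (runsFrom-cong (c′ 0) (c≗c′ ∘ suc) i)
runsFrom-cong (suc m) c≗c′ zero = refl
runsFrom-cong (suc m) c≗c′ (suc i) = runsFrom-cong m c≗c′ i

runs-cong : ∀ {c c′} → c ≗ c′ → runs c ≐ runs c′
runs-cong {c} {c′} c≗c′ i =
  trans (cong (λ k → runsFrom k (c ∘ suc) i) (c≗c′ 0)) (runsFrom-cong (c′ 0) (c≗c′ ∘ suc) i)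

runsFrom-injective : ∀ m m′ {c c′} → runsFrom m c ≐ runsFrom m′ c′ → m ≡ m′ × runs c ≐ runs c′
runsFrom-injective zero zero eq = refl , eq ∘ suc
runsFrom-injective zero (suc m′) eq with () ← eq 0
runsFrom-injective (suc m) zero eq with () ← eq 0
runsFrom-injective (suc m) (suc m′) eq with runsFrom-injective m m′ (eq ∘ suc)
... | m≡m′ , rest = cong suc m≡m′ , rest

runs-injective : ∀ {c c′} → runs c ≐ runs c′ → c ≗ c′
runs-injective {c} {c′} eq zero = proj₁ (runsFrom-injective (c 0) (c′ 0) eq)
runs-injective {c} {c′} eq (suc i) = runs-injective {c ∘ suc} {c′ ∘ suc} (proj₂ (runsFrom-injective (c 0) (c′ 0) eq)) i

runsFrom-after-false : ∀ m c n → runsFrom m c n ≡ false →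
  ∃ λ k → shift (suc n) (runsFrom m c) ≐ runs (λ j → c (k + j))
runsFrom-after-false zero c zero _ = 0 , λ i → refl
runsFrom-after-false zero c (suc n) eq with runsFrom-after-false (c 0) (c ∘ suc) n eq
... | k , tail≐ = suc k , tail≐
runsFrom-after-false (suc m) c (suc n) eq = runsFrom-after-false m c n eq

runsFrom-<ₗ : ∀ m c c′ → runsFrom m c <ₗ runsFrom (suc m) c′
runsFrom-<ₗ zero c c′ = 0 , (λ _ ()) , refl , refl
runsFrom-<ₗ (suc m) c c′ = <ₗ-resp-≐ split split (∷ˢ-monoʳ-<ₗ true (runsFrom-<ₗ m c c′))
  where
  split : ∀ {k d} → true ∷ˢ runsFrom k d ≐ runsFrom (suc k) d
  split zero = refl
  split (suc i) = refl

runsFrom-monoʳ-<ₗ : ∀ m {c c′} → runs c <ₗ runs c′ → runsFrom m c <ₗ runsFrom m c′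
runsFrom-monoʳ-<ₗ m {c} {c′} c<c′ =
  <ₗ-resp-≐ (≐-sym (runsFrom-unfold m c)) (≐-sym (runsFrom-unfold m c′)) (++ˢ-monoʳ-<ₗ (run m) c<c′)

runLength : ℕ → Bool → ℕ
runLength m true = suc m
runLength m false = m

runLength-injective : ∀ m {a b} → runLength m a ≡ runLength m b → a ≡ b
runLength-injective m {true} {true} _ = refl
runLength-injective m {true} {false} eq with () ← 1+n≢n eq
runLength-injective m {false} {true} eq with () ← 1+n≢n (sym eq)
runLength-injective m {false} {false} _ = refl

Φʷ : ℕ → Word → Word
Φʷ m = concatMap (run ∘ runLength m)

Φˢ : ℕ → Seq → Seq
Φˢ m x = runs (runLength m ∘ x)

Φˢ-cong : ∀ m {x y} → x ≐ y → Φˢ m x ≐ Φˢ m y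
Φˢ-cong m x≐y = runs-cong (cong (runLength m) ∘ x≐y)

Φˢ-injective : ∀ m {x y} → Φˢ m x ≐ Φˢ m y → x ≐ y
Φˢ-injective m eq = runLength-injective m ∘ runs-injective eq

Φʷ-++ˢ-Φˢ : ∀ m w x → Φʷ m w ++ˢ Φˢ m x ≐ Φˢ m (w ++ˢ x)
Φʷ-++ˢ-Φˢ m [] x = ≐-refl
Φʷ-++ˢ-Φˢ m (b ∷ w) x = begin
  (run k ++ Φʷ m w) ++ˢ Φˢ m x      ≈⟨ ++ˢ-assoc (run k) (Φʷ m w) (Φˢ m x) ⟩
  run k ++ˢ (Φʷ m w ++ˢ Φˢ m x)     ≈⟨ ++ˢ-congʳ (run k) (Φʷ-++ˢ-Φˢ m w x) ⟩
  run k ++ˢ Φˢ m (w ++ˢ x)          ≈⟨ runsFrom-unfold k _ ⟨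
  Φˢ m (b ∷ˢ (w ++ˢ x))             ∎
  where
  open ≐-Reasoning
  k : ℕ
  k = runLength m b

ω-Φʷ : ∀ m w → 0 < length w → ω (Φʷ m w) ≐ Φˢ m (ω w)
ω-Φʷ m w@(b ∷ v) 0<|w| =
  fixpoint-unique (Φʷ m w) 0<|Φw| (ω-unfold (Φʷ m w) 0<|Φw|)
    (≐-trans (Φˢ-cong m (ω-unfold w 0<|w|)) (≐-sym (Φʷ-++ˢ-Φˢ m w (ω w))))
  where
  0<|Φw| : 0 < length (Φʷ m w)
  0<|Φw| = ≤-trans (0<length-run (runLength m b)) (length-++-≤ˡ (run (runLength m b)))

Φˢ-mono-<ₗ : ∀ m {x y} → x <ₗ y → Φˢ m x <ₗ Φˢ m y
Φˢ-mono-<ₗ m (n , agree , xₙ , yₙ) = differing-at n agree xₙ yₙ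
  where
  differing-at : ∀ n {x y} → (∀ i → i < n → x i ≡ y i) → x n ≡ false → y n ≡ true → Φˢ m x <ₗ Φˢ m y
  differing-at zero _ x₀ y₀ rewrite x₀ | y₀ = runsFrom-<ₗ m _ _
  differing-at (suc n) {x} {y} agree xₙ yₙ rewrite agree 0 (s≤s z≤n) =
    runsFrom-monoʳ-<ₗ (runLength m (y 0)) (differing-at n (λ i i<n → agree (suc i) (s≤s i<n)) xₙ yₙ)

Φˢ-mono-≤ₗ : ∀ m {x y} → x ≤ₗ y → Φˢ m x ≤ₗ Φˢ m y
Φˢ-mono-≤ₗ m (inj₁ x<y) = inj₁ (Φˢ-mono-<ₗ m x<y)
Φˢ-mono-≤ₗ m (inj₂ x≐y) = inj₂ (Φˢ-cong m x≐y)

TailMinimal : Seq → Set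
TailMinimal x = ∀ k → x ≤ₗ shift (suc k) x

Φˢ-zeroCondition : ∀ m x → TailMinimal x → ZeroCondition (Φˢ m x)
Φˢ-zeroCondition m x x-min n Φx≡0 with runsFrom-after-false (runLength m (x 0)) (runLength m ∘ x ∘ suc) n Φx≡0
... | k , tail≐ = ≤ₗ-resp-≐ ≐-refl (≐-sym tail≐) (Φˢ-mono-≤ₗ m (x-min k))

zeroCondition⇒tailMinimal : ∀ {z} → ZeroCondition z → TailMinimal (false ∷ˢ z)
zeroCondition⇒tailMinimal {z} zc k with z k in zₖ
... | true = inj₁ (0 , (λ _ ()) , refl , shift-∷ˢ k z zₖ 0)
... | false = ≤ₗ-resp-≐ ≐-refl (≐-sym (shift-∷ˢ k z zₖ)) (∷ˢ-monoʳ-≤ₗ false (zc k zₖ))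

-- Identities between the blocks

pow-suc-snoc : ∀ (w : Word) k → pow w (suc k) ≡ pow w k ++ w
pow-suc-snoc w zero = ++-identityʳ w
pow-suc-snoc w (suc k) = trans (cong (w ++_) (pow-suc-snoc w k)) (sym (++-assoc w (pow w k) w))

pow-singleton : ∀ (b : Bool) k → pow (b ∷ []) k ≡ replicate k b
pow-singleton b zero = refl
pow-singleton b (suc k) = cong (b ∷_) (pow-singleton b k)

pow-∷-++-∷ : ∀ (b : Bool) v k u → ∃ λ u′ → pow (b ∷ v) k ++ b ∷ u ≡ b ∷ u′
pow-∷-++-∷ b v zero u = u , refl
pow-∷-++-∷ b v (suc k) u = _ , refl

Φʷ-concatMap : ∀ m (f : ℕ → Word) xs → Φʷ m (concatMap f xs) ≡ concatMap (Φʷ m ∘ f) xs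
Φʷ-concatMap m f [] = refl
Φʷ-concatMap m f (x ∷ xs) =
  trans (concatMap-++ _ (f x) (concatMap f xs)) (cong (Φʷ m (f x) ++_) (Φʷ-concatMap m f xs))

Φʷ-pow : ∀ m w k → Φʷ m (pow w k) ≡ pow (Φʷ m w) k
Φʷ-pow m w zero = refl
Φʷ-pow m w (suc k) = trans (concatMap-++ _ w (pow w k)) (cong (Φʷ m w ++_) (Φʷ-pow m w k))

concatMap-upTo-suc : ∀ (f : ℕ → Word) M → concatMap f (upTo (suc M)) ≡ f 0 ++ concatMap (f ∘ suc) (upTo M)
concatMap-upTo-suc f M =
  cong (λ ws → f 0 ++ concat ws) (trans (map-applyUpTo suc f M) (sym (map-upTo (f ∘ suc) M)))

positive-pred : ∀ {N h j} → PositiveUpTo N h → 1 ≤ j → j ≤ N → h j ≡ suc (h j ∸ 1)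
positive-pred {h = h} {j} pos 1≤j j≤N with h j | pos j 1≤j j≤N
... | suc k | _ = refl

positive-first : ∀ {N h} → PositiveUpTo (suc N) h → h 1 ≡ suc (h 1 ∸ 1)
positive-first pos = positive-pred pos (s≤s z≤n) (s≤s z≤n)

positive-tail : ∀ {N h} → PositiveUpTo (suc N) h → PositiveUpTo N (h ∘ suc)
positive-tail pos j _ j≤N = pos (suc j) (s≤s z≤n) (s≤s j≤N)

positive-init : ∀ {N h} → PositiveUpTo (suc N) h → PositiveUpTo N h
positive-init pos j 1≤j j≤N = pos j 1≤j (m≤n⇒m≤1+n j≤N)

positive-last : ∀ {N h} → PositiveUpTo (suc N) h → h (suc N) ≡ suc (h (suc N) ∸ 1)
positive-last pos = positive-pred pos (s≤s z≤n) ≤-refl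

prefixBlocks-suc : ∀ h M → prefixBlocks h (suc M) ≡ prefixBlocks h M ++ S h (suc M) false
prefixBlocks-suc h M = begin
  concatMap f (upTo (suc M))            ≡⟨ cong (concatMap f) (upTo-∷ʳ M) ⟨
  concatMap f (upTo M ++ M ∷ [])        ≡⟨ concatMap-++ f (upTo M) (M ∷ []) ⟩
  concatMap f (upTo M) ++ (f M ++ [])   ≡⟨ cong (concatMap f (upTo M) ++_) (++-identityʳ (f M)) ⟩
  concatMap f (upTo M) ++ f M           ∎
  where
  open ≡-Reasoning
  f : ℕ → Word
  f j = S h (suc j) false

module _ (h : ℕ → ℕ) (j : ℕ) {k : ℕ} (hⱼ₊₁ : h (suc j) ≡ suc k) where

  S-false-unfold : S h (suc j) false ≡ pow (S h j true) k ++ S h j false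
  S-false-unfold = cong (λ n → pow (S h j true) (n ∸ 1) ++ S h j false) hⱼ₊₁

  S-true-unfold : S h (suc j) true ≡ pow (S h j true) k ++ S h j true ++ S h j false
  S-true-unfold rewrite hⱼ₊₁ =
    trans (cong (_++ S h j false) (pow-suc-snoc (S h j true) k)) (++-assoc (pow (S h j true) k) _ _)

  S-true-split : S h (suc j) true ≡ S h j true ++ S h (suc j) false
  S-true-split rewrite hⱼ₊₁ = ++-assoc (S h j true) (pow (S h j true) k) (S h j false)

S-head : ∀ M h → PositiveUpTo M h → S h M true ≡ true ∷ prefixBlocks h M
S-head zero h _ = refl
S-head (suc M) h pos = begin
  S h (suc M) true                                  ≡⟨ S-true-split h M (positive-last pos) ⟩
  S h M true ++ S h (suc M) false                   ≡⟨ cong (_++ S h (suc M) false) (S-head M h (positive-init pos)) ⟩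
  true ∷ prefixBlocks h M ++ S h (suc M) false      ≡⟨ cong (true ∷_) (prefixBlocks-suc h M) ⟨
  true ∷ prefixBlocks h (suc M)                     ∎
  where open ≡-Reasoning

0<length-S : ∀ M h → PositiveUpTo M h → 0 < length (S h M true)
0<length-S M h pos = subst (λ w → 0 < length w) (sym (S-head M h pos)) (s≤s z≤n)

S-true-suffix : ∀ M h → PositiveUpTo (suc M) h → ∃ λ A → S h (suc M) true ≡ true ∷ A ++ prefixBlocks h M
S-true-suffix zero h pos = prefixBlocks h 1 , trans (S-head 1 h pos) (cong (true ∷_) (sym (++-identityʳ _)))
S-true-suffix (suc M) h pos =
  let A , W≡ = S-true-suffix M h (positive-init pos)
      A′ , head≡ = pow-∷-++-∷ true (A ++ P) k A
      W′ : Word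
      W′ = true ∷ A ++ P
  in A′ , (begin
    S h (suc (suc M)) true                    ≡⟨ S-true-unfold h (suc M) (positive-last pos) ⟩
    pow W k ++ W ++ Z                         ≡⟨ cong (λ w → pow w k ++ w ++ Z) W≡ ⟩
    pow W′ k ++ (true ∷ A ++ P) ++ Z          ≡⟨ cong (λ w → pow W′ k ++ true ∷ w) (++-assoc A P Z) ⟩
    pow W′ k ++ true ∷ A ++ P ++ Z            ≡⟨ ++-assoc (pow W′ k) (true ∷ A) (P ++ Z) ⟨
    (pow W′ k ++ true ∷ A) ++ P ++ Z          ≡⟨ cong₂ _++_ head≡ (sym (prefixBlocks-suc h M)) ⟩
    true ∷ A′ ++ prefixBlocks h (suc M)       ∎)
  where
  open ≡-Reasoning
  k : ℕ
  k = h (suc (suc M)) ∸ 1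
  W Z P : Word
  W = S h (suc M) true
  Z = S h (suc M) false
  P = prefixBlocks h M

S-common-prefix : ∀ j h → PositiveUpTo j h →
  ∃ λ C → ∃₂ λ R₀ R₁ → (S h j false ≡ C ++ false ∷ R₀) × (S h j true ≡ C ++ true ∷ R₁)
S-common-prefix zero h _ = [] , [] , [] , refl , refl
S-common-prefix (suc j) h pos =
  let C , R₀ , R₁ , Z≡ , W≡ = S-common-prefix j h (positive-init pos)
  in pow W k ++ C , R₀ , R₁ ++ Z ,
     (begin
       S h (suc j) false              ≡⟨ S-false-unfold h j hⱼ₊₁ ⟩
       pow W k ++ Z                   ≡⟨ cong (pow W k ++_) Z≡ ⟩
       pow W k ++ C ++ false ∷ R₀     ≡⟨ ++-assoc (pow W k) C _ ⟨
       (pow W k ++ C) ++ false ∷ R₀   ∎) ,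
     (begin
       S h (suc j) true                   ≡⟨ S-true-unfold h j hⱼ₊₁ ⟩
       pow W k ++ W ++ Z                  ≡⟨ cong (λ w → pow W k ++ w ++ Z) W≡ ⟩
       pow W k ++ (C ++ true ∷ R₁) ++ Z   ≡⟨ cong (pow W k ++_) (++-assoc C (true ∷ R₁) Z) ⟩
       pow W k ++ C ++ true ∷ R₁ ++ Z     ≡⟨ ++-assoc (pow W k) C _ ⟨
       (pow W k ++ C) ++ true ∷ R₁ ++ Z   ∎)
  where
  open ≡-Reasoning
  hⱼ₊₁ : h (suc j) ≡ suc (h (suc j) ∸ 1)
  hⱼ₊₁ = positive-last pos
  k : ℕ
  k = h (suc j) ∸ 1
  W Z : Word
  W = S h j true
  Z = S h j false

S-false-last : ∀ h j → ∃ λ u → S h j false ≡ u ++ false ∷ []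
S-false-last h zero = [] , refl
S-false-last h (suc j) =
  let u , Z≡ = S-false-last h j
      V : Word
      V = pow (S h j true) (h (suc j) ∸ 1)
  in V ++ u , trans (cong (V ++_) Z≡) (sym (++-assoc V u (false ∷ [])))

module _ (h : ℕ → ℕ) {m : ℕ} (h₁ : h 1 ≡ suc m) where

  S-Φʷ : ∀ j b → S h (suc j) b ≡ Φʷ m (S (h ∘ suc) j b)
  S-Φʷ-step : ∀ j k → pow (S h (suc j) true) k ++ S h (suc j) false
                    ≡ Φʷ m (pow (S (h ∘ suc) j true) k ++ S (h ∘ suc) j false)
  S-Φʷ zero true rewrite h₁ = trans (cong (_++ false ∷ []) (pow-singleton true (suc m))) (sym (++-identityʳ _))
  S-Φʷ zero false rewrite h₁ = trans (cong (_++ false ∷ []) (pow-singleton true m)) (sym (++-identityʳ _))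
  S-Φʷ (suc j) true = S-Φʷ-step j (h (suc (suc j)))
  S-Φʷ (suc j) false = S-Φʷ-step j (h (suc (suc j)) ∸ 1)

  S-Φʷ-step j k = begin
    pow (S h (suc j) true) k ++ S h (suc j) false
      ≡⟨ cong₂ (λ u v → pow u k ++ v) (S-Φʷ j true) (S-Φʷ j false) ⟩
    pow (Φʷ m W) k ++ Φʷ m Z
      ≡⟨ cong (_++ Φʷ m Z) (Φʷ-pow m W k) ⟨
    Φʷ m (pow W k) ++ Φʷ m Z
      ≡⟨ concatMap-++ _ (pow W k) Z ⟨
    Φʷ m (pow W k ++ Z)
      ∎
    where
    open ≡-Reasoning
    W Z : Word
    W = S (h ∘ suc) j true
    Z = S (h ∘ suc) j false

  prefixBlocks-Φʷ : ∀ M → prefixBlocks h (suc M) ≡ Φʷ m (false ∷ prefixBlocks (h ∘ suc) M)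
  prefixBlocks-Φʷ M = begin
    concatMap (λ j → S h (suc j) false) (upTo (suc M))
      ≡⟨ concatMap-cong (λ j → S-Φʷ j false) (upTo (suc M)) ⟩
    concatMap (Φʷ m ∘ Z) (upTo (suc M))
      ≡⟨ Φʷ-concatMap m Z (upTo (suc M)) ⟨
    Φʷ m (concatMap Z (upTo (suc M)))
      ≡⟨ cong (Φʷ m) (concatMap-upTo-suc Z M) ⟩
    Φʷ m (false ∷ prefixBlocks (h ∘ suc) M)
      ∎
    where
    open ≡-Reasoning
    Z : ℕ → Word
    Z j = S (h ∘ suc) j false

S-true-last : ∀ j h → PositiveUpTo (suc j) h → ∃ λ u → S h (suc j) true ≡ u ++ false ∷ []
S-true-last j h pos =
  let u , Z≡ = S-false-last h (suc j)
  in S h j true ++ u ,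
     trans (S-true-split h j (positive-last pos))
           (trans (cong (S h j true ++_) Z≡) (sym (++-assoc (S h j true) u (false ∷ []))))

S-false<ₗS-true : ∀ j h → PositiveUpTo j h → ∀ s t → S h j false ++ˢ s <ₗ S h j true ++ˢ t
S-false<ₗS-true j h pos s t =
  let C , R₀ , R₁ , Z≡ , W≡ = S-common-prefix j h pos
  in <ₗ-resp-≐ (≐-sym (≐-trans (≐-reflexive (cong (_++ˢ s) Z≡)) (++ˢ-assoc C (false ∷ R₀) s)))
               (≐-sym (≐-trans (≐-reflexive (cong (_++ˢ t) W≡)) (++ˢ-assoc C (true ∷ R₁) t)))
               (++ˢ-monoʳ-<ₗ C false∷ˢ<ₗtrue∷ˢ)

S-1-true : ∀ h → S h 1 true ≡ run (h 1)
S-1-true h = cong (_++ false ∷ []) (pow-singleton true (h 1))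

-- The finite type

ω-S-Φˢ : ∀ j h → PositiveUpTo (suc j) h → ω (S h (suc j) true) ≐ Φˢ (h 1 ∸ 1) (ω (S (h ∘ suc) j true))
ω-S-Φˢ j h pos = ≐-trans (≐-reflexive (cong ω (S-Φʷ h (positive-first pos) j true)))
                         (ω-Φʷ (h 1 ∸ 1) (S (h ∘ suc) j true) (0<length-S j (h ∘ suc) (positive-tail pos)))

ω-S-head : ∀ M h → PositiveUpTo M h → ω (S h M true) 0 ≡ true
ω-S-head M h pos = cong (λ w → ω w 0) (S-head M h pos)

ω-S-has-false : ∀ j h → PositiveUpTo (suc j) h → ∃ λ i → ω (S h (suc j) true) i ≡ false
ω-S-has-false j h pos =
  let u , W≡ = S-true-last j h pos
  in length u , trans (ω-unfold W (0<length-S (suc j) h pos) (length u))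
                      (subst (λ w → (w ++ˢ ω W) (length u) ≡ false) (sym W≡)
                             (++ˢ-lookup-length u false [] (ω W)))
  where
  W : Word
  W = S h (suc j) true

ω-run : ∀ c → ω (run c) ≐ runs (λ _ → c)
ω-run c = fixpoint-unique (run c) (0<length-run c) (ω-unfold (run c) (0<length-run c)) (runsFrom-unfold c _)

zeroCondition-resp : ∀ {a b} → a ≐ b → ZeroCondition a → ZeroCondition b
zeroCondition-resp a≐b zc n bₙ = ≤ₗ-resp-≐ a≐b (shift-cong (suc n) a≐b) (zc n (trans (a≐b n) bₙ))

-- The paper's d′ for N = M + 1, namely S(1,0)⋯S(M,0) S(M+1,1)^∞.
d′ : ℕ → (ℕ → ℕ) → Seq
d′ M h = prefixBlocks h M ++ˢ ω (S h (suc M) true)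

d′-Φˢ : ∀ M h → PositiveUpTo (suc (suc M)) h → d′ (suc M) h ≐ Φˢ (h 1 ∸ 1) (false ∷ˢ d′ M (h ∘ suc))
d′-Φˢ M h pos = begin
  prefixBlocks h (suc M) ++ˢ ω (S h (suc (suc M)) true)
    ≡⟨ cong (_++ˢ ω (S h (suc (suc M)) true)) (prefixBlocks-Φʷ h (positive-first pos) M) ⟩
  Φʷ m (false ∷ P′) ++ˢ ω (S h (suc (suc M)) true)
    ≈⟨ ++ˢ-congʳ (Φʷ m (false ∷ P′)) (ω-S-Φˢ (suc M) h pos) ⟩
  Φʷ m (false ∷ P′) ++ˢ Φˢ m (ω W′)
    ≈⟨ Φʷ-++ˢ-Φˢ m (false ∷ P′) (ω W′) ⟩
  Φˢ m (false ∷ˢ d′ M (h ∘ suc))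
    ∎
  where
  open ≐-Reasoning
  m : ℕ
  m = h 1 ∸ 1
  P′ W′ : Word
  P′ = prefixBlocks (h ∘ suc) M
  W′ = S (h ∘ suc) (suc M) true

d′-zeroCondition : ∀ M h → PositiveUpTo (suc M) h → ZeroCondition (d′ M h)
d′-zeroCondition zero h pos =
  zeroCondition-resp (≐-sym (≐-trans (ω-S-Φˢ 0 h pos) (Φˢ-cong (h 1 ∸ 1) (ω-singleton true))))
                     (Φˢ-zeroCondition (h 1 ∸ 1) ones (λ k → inj₂ λ _ → refl))
d′-zeroCondition (suc M) h pos =
  zeroCondition-resp (≐-sym (d′-Φˢ M h pos))
    (Φˢ-zeroCondition (h 1 ∸ 1) _ (zeroCondition⇒tailMinimal (d′-zeroCondition M (h ∘ suc) (positive-tail pos))))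

d′≉ω-S : ∀ M h → PositiveUpTo (suc (suc M)) h → ¬ (d′ (suc M) h ≐ ω (S h (suc (suc M)) true))
d′≉ω-S M h pos d′≐ =
  false≢true (trans (Φˢ-injective (h 1 ∸ 1) {false ∷ˢ d′ M (h ∘ suc)} {ω (S (h ∘ suc) (suc M) true)} preimages 0)
                    (ω-S-head (suc M) (h ∘ suc) (positive-tail pos)))
  where
  preimages : Φˢ (h 1 ∸ 1) (false ∷ˢ d′ M (h ∘ suc)) ≐ Φˢ (h 1 ∸ 1) (ω (S (h ∘ suc) (suc M) true))
  preimages = ≐-trans (≐-sym (d′-Φˢ M h pos)) (≐-trans d′≐ (ω-S-Φˢ (suc M) h pos))

ω-S-aperiodic : ∀ M h c → PositiveUpTo (suc (suc M)) h → ¬ (ω (S h (suc (suc M)) true) ≐ ω (run c))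
ω-S-aperiodic M h c pos eq =
  false≢true (trans (sym xᵢ≡false) (trans (sym x₀≡xᵢ) (ω-S-head (suc M) (h ∘ suc) (positive-tail pos))))
  where
  m : ℕ
  m = h 1 ∸ 1
  x : Seq
  x = ω (S (h ∘ suc) (suc M) true)
  all-runs-c : runLength m ∘ x ≗ λ _ → c
  all-runs-c = runs-injective (≐-trans (≐-sym (ω-S-Φˢ (suc M) h pos)) (≐-trans eq (ω-run c)))
  i : ℕ
  i = proj₁ (ω-S-has-false M (h ∘ suc) (positive-tail pos))
  xᵢ≡false : x i ≡ false
  xᵢ≡false = proj₂ (ω-S-has-false M (h ∘ suc) (positive-tail pos))
  x₀≡xᵢ : x 0 ≡ x i
  x₀≡xᵢ = runLength-injective m (trans (all-runs-c 0) (sym (all-runs-c i)))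

finite-periodic : ∀ M h {d} → PositiveUpTo (suc M) h → d ≐ ω (S h (suc M) true) →
  (d′ M h ≐ d) ⇔ IsPeriodicOnesZero d
finite-periodic zero h _ d≐ω =
  mk⇔ (λ _ → suc (h 1) , s≤s z≤n , ≐-trans d≐ω (≐-reflexive (cong ω (S-1-true h))))
      (λ _ → ≐-sym d≐ω)
finite-periodic (suc M) h pos d≐ω =
  mk⇔ (λ d′≐d → ⊥-elim (d′≉ω-S M h pos (≐-trans d′≐d d≐ω)))
      (λ (k , _ , d≐run) → ⊥-elim (ω-S-aperiodic M h (k ∸ 1) pos (≐-trans (≐-sym d≐ω) d≐run)))

module FiniteType {d : Seq} {M : ℕ} {h : ℕ → ℕ}
                  (pos : PositiveUpTo (suc M) h) (d≐ω : d ≐ ω (S h (suc M) true)) where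

  W Z P : Word
  W = S h (suc M) true
  Z = S h (suc M) false
  P = prefixBlocks h M

  X : Seq
  X = ω W

  d≐W++ˢX : d ≐ W ++ˢ X
  d≐W++ˢX = ≐-trans d≐ω (ω-unfold W (0<length-S (suc M) h pos))

  A : Word
  A = proj₁ (S-true-suffix M h pos)

  W≡1AP : W ≡ true ∷ A ++ P
  W≡1AP = proj₂ (S-true-suffix M h pos)

  ℓ-difference : ℓ h (suc M) ∸ ℓ h M ≡ length A
  ℓ-difference = begin
    ℓ h (suc M) ∸ ℓ h M                 ≡⟨ cong₂ _∸_ (cong length W≡1AP) (cong length (S-head M h (positive-init pos))) ⟩
    length (A ++ P) ∸ length P          ≡⟨ cong (_∸ length P) (length-++ A) ⟩
    length A + length P ∸ length P      ≡⟨ m+n∸n≡m (length A) (length P) ⟩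
    length A                            ∎
    where open ≡-Reasoning

  shift≐d′ : shift (1 + (ℓ h (suc M) ∸ ℓ h M)) d ≐ d′ M h
  shift≐d′ = begin
    shift (1 + (ℓ h (suc M) ∸ ℓ h M)) d        ≡⟨ cong (λ n → shift (suc n) d) ℓ-difference ⟩
    shift (length (true ∷ A)) d                 ≈⟨ shift-cong (length (true ∷ A)) d≐W++ˢX ⟩
    shift (length (true ∷ A)) (W ++ˢ X)         ≡⟨ cong (λ w → shift (length (true ∷ A)) (w ++ˢ X)) W≡1AP ⟩
    shift (length (true ∷ A)) ((true ∷ A ++ P) ++ˢ X)
                                                ≈⟨ shift-cong (length (true ∷ A)) (++ˢ-assoc (true ∷ A) P X) ⟩
    shift (length (true ∷ A)) ((true ∷ A) ++ˢ P ++ˢ X)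
                                                ≈⟨ shift-++ˢ (true ∷ A) (P ++ˢ X) ⟩
    P ++ˢ X                                     ∎
    where open ≐-Reasoning

  tail≐ : shift 1 d ≐ (P ++ Z) ++ˢ X
  tail≐ = begin
    shift 1 d                                  ≈⟨ shift-cong 1 d≐W++ˢX ⟩
    shift 1 (W ++ˢ X)                          ≡⟨ cong (λ w → shift 1 (w ++ˢ X)) (S-head (suc M) h pos) ⟩
    prefixBlocks h (suc M) ++ˢ X               ≡⟨ cong (_++ˢ X) (prefixBlocks-suc h M) ⟩
    (P ++ Z) ++ˢ X                             ∎
    where open ≐-Reasoning

  tail<ₗd′ : shift 1 d <ₗ d′ M h
  tail<ₗd′ = <ₗ-resp-≐ (≐-sym (≐-trans tail≐ (++ˢ-assoc P Z X)))
                       (≐-sym (++ˢ-congʳ P (ω-unfold W (0<length-S (suc M) h pos))))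
                       (++ˢ-monoʳ-<ₗ P (S-false<ₗS-true (suc M) h pos X X))

  shift≐d⇔periodic : (shift (1 + (ℓ h (suc M) ∸ ℓ h M)) d ≐ d) ⇔ IsPeriodicOnesZero d
  shift≐d⇔periodic =
    mk⇔ (to ∘ ≐-trans (≐-sym shift≐d′)) (≐-trans shift≐d′ ∘ from)
    where open Equivalence (finite-periodic M h pos d≐ω)

-- The infinite type

admissible⇒zeroCondition-tail : ∀ {d} → Admissible d → ZeroCondition (shift 1 d)
admissible⇒zeroCondition-tail {d} adm n dₙ₊₁≡0 =
  ∷ˢ-cancelˡ-≤ₗ false (≤ₗ-resp-≐ zeroHead≐ (shift-∷ˢ (suc n) d dₙ₊₁≡0) (proj₁ (adm (suc n))))
  where
  zeroHead≐ : zeroHead d ≐ false ∷ˢ shift 1 d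
  zeroHead≐ zero = refl
  zeroHead≐ (suc i) = refl

shift-invariant⇒constant : ∀ {d} → shift 1 d ≐ d → ∀ i → d i ≡ d 0
shift-invariant⇒constant eq zero = refl
shift-invariant⇒constant eq (suc i) = trans (eq i) (shift-invariant⇒constant eq i)

infinite-periodic : ∀ {d} → ¬ (d ≐ ones) → InfiniteType d → (shift 1 d ≐ d) ⇔ IsPeriodicOnesZero d
infinite-periodic {d} d≉1 infinite = mk⇔ to from
  where
  to : shift 1 d ≐ d → IsPeriodicOnesZero d
  to eq with d 0 in d₀
  ... | true = ⊥-elim (d≉1 λ i → trans (shift-invariant⇒constant eq i) d₀)
  ... | false =
    1 , s≤s z≤n , λ i → trans (shift-invariant⇒constant eq i) (trans d₀ (sym (ω-singleton false i)))
  from : IsPeriodicOnesZero d → shift 1 d ≐ d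
  from (suc zero , _ , d≐) i =
    trans (trans (d≐ (suc i)) (ω-singleton false (suc i))) (sym (trans (d≐ i) (ω-singleton false i)))
  from (suc (suc k) , _ , d≐) =
    ⊥-elim (infinite (1 , (λ _ → suc k) , (λ _ _ _ → s≤s z≤n) ,
                      ≐-trans d≐ (≐-reflexive (cong ω (sym (S-1-true (λ _ → suc k)))))))

lemma3p4 : (d : Seq) → Admissible d → ¬ (d ≐ ones) →
    -- (a) and (c) for finite type, d' = d_{i+1+ℓ_N-ℓ_{N-1}}
    ((N : ℕ) (h : ℕ → ℕ) → FiniteTypeWith d N h →
      (1 ≤ N)
      × ZeroCondition (shift (1 + (ℓ h N ∸ ℓ h (N ∸ 1))) d)
      × (shift 1 d <ₗ shift (1 + (ℓ h N ∸ ℓ h (N ∸ 1))) d)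
      × (shift (1 + (ℓ h N ∸ ℓ h (N ∸ 1))) d
           ≐ (prefixBlocks h (N ∸ 1) ⊕ ω (S h N true)))
      × (shift 1 d ≐ ((prefixBlocks h (N ∸ 1) ++ S h N false) ⊕ ω (S h N true)))
      × ((shift (1 + (ℓ h N ∸ ℓ h (N ∸ 1))) d ≐ d) ⇔ IsPeriodicOnesZero d))
    -- (b) and (c) for infinite type, d' = d_{1+i}
    × (InfiniteType d →
      ZeroCondition (shift 1 d)
      × ((shift 1 d ≐ d) ⇔ IsPeriodicOnesZero d))
lemma3p4 d adm d≉1 =
  (λ where
    zero h (_ , d≐ω) → ⊥-elim (d≉1 (≐-trans d≐ω (ω-singleton true)))
    (suc M) h (pos , d≐ω) → let open FiniteType pos d≐ω in
      s≤s z≤n ,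
      zeroCondition-resp (≐-sym shift≐d′) (d′-zeroCondition M h pos) ,
      <ₗ-resp-≐ ≐-refl (≐-sym shift≐d′) tail<ₗd′ ,
      ≐-trans shift≐d′ (++ˢ≐⊕ P X) ,
      ≐-trans tail≐ (++ˢ≐⊕ (P ++ Z) X) ,
      shift≐d⇔periodic) ,
  λ infinite → admissible⇒zeroCondition-tail adm , infinite-periodic d≉1 infinite
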